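{- Let $\mathcal S_1\subseteq\{V,P,N\}$ and $\mathcal S_2\subseteq\{SV,SP\}$ with $|\mathcal S_2|\ge 1$. Then for every $n\ge 1$ $$CGD\mathcal S_1\mathcal S_2(n)=\begin{cases}1&\text{if } n=2,\\0&\text{otherwise,}\end{cases}\qquad CGD\mathcal S_1\mathcal S_2(n,t)=\begin{cases}1&\text{if } n=t=2,\\0&\text{otherwise.}\end{cases}$$
   Context: A simple game is a pair $(N,W)$ with $N=\{1,\dots,n\}$ and $W$ a family of subsets of $N$ (the winning coalitions) such that $N\in W$, $\emptyset\notin W$, and $S\in W$, $S\subseteq T\subseteq N$ imply $T\in W$. $W^m$ denotes the set of inclusion-minimal winning coalitions. Players $i,j$ are equally desirable ($i\approx j$) if $S\cup\{i\}\in W\iff S\cup\{j\}\in W$ for all $S\subseteq N\setminus\{i,j\}$; $i\succsim j$ if $S\cup\{j\}\in W\Rightarrow S\cup\{i\}\in W$ for all $S\subseteq N\setminus\{i,j\}$. The game is complete if $\succsim$ is a complete preorder. The number of types $t$ is the number of equivalence classes of $\approx$. Player $i$: is a dictator if $W^m=\{\{i\}\}$; has veto (V) if $i\in S$ for all $S\in W$; is a passer (P) if $\{i\}\in W$; is null (N) if $i\notin S$ for all $S\in W^m$; has semi-veto (SV) if $N\setminus\{i\}\in W$ and $i\in S$ for every $S\in W$ other than $N\setminus\{i\}$; is a semi-passer (SP) if $\{i\}\notin W$ and $\{i,j\}\in W$ for all $j\ne i$. For a set $\mathcal S$ of these labels, $CGD\mathcal S(n)$ is the number of isomorphism classes (isomorphism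 = bijection of players preserving winning coalitions) of complete simple games with $n$ players that contain a dictator and, for each label in $\mathcal S$, at least one player of that kind (different roles may be taken by the same player); $CGD\mathcal S(n,t)$ is the number of those with exactly $t$ types. -}

module Defs where

open import Data.Nat using (ℕ)
open import Data.Bool using (Bool; true; false)
open import Data.Fin using (Fin)
open import Data.Fin.Subset using (Subset; _∈_; _∉_; _⊆_; ⁅_⁆; ∁; _∪_; ⊤; ⊥)
open import Data.Fin.Permutation using (Permutation′; _⟨$⟩ʳ_; _⟨$⟩ˡ_)
open import Data.Vec using (tabulate; lookup)
open import Data.List using (List)
open import Data.List.Membership.Propositional using () renaming (_∈_ to _∈ₗ_)
open import Data.Product using (Σ; _×_; ∃)
open import Data.Sum using (_⊎_)
open import Relation.Binary.PropositionalEquality using (_≡_; _≢_)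
open import Relation.Nullary using (¬_)

Game : ℕ → Set
Game n = Subset n → Bool

module _ {n : ℕ} (W : Game n) where

  Win : Subset n → Set
  Win S = W S ≡ true

  IsSimpleGame : Set
  IsSimpleGame = Win ⊤ × ¬ Win ⊥ × (∀ S T → S ⊆ T → Win S → Win T)

  MinWin : Subset n → Set
  MinWin S = Win S × (∀ T → T ⊆ S → Win T → T ≡ S)

  EqDes : Fin n → Fin n → Set
  EqDes i j = ∀ S → i ∉ S → j ∉ S → (Win (S ∪ ⁅ i ⁆) → Win (S ∪ ⁅ j ⁆)) × (Win (S ∪ ⁅ j ⁆) → Win (S ∪ ⁅ i ⁆))

  AtLeast : Fin n → Fin n → Set
  AtLeast i j = ∀ S → i ∉ S → j ∉ S → Win (S ∪ ⁅ j ⁆) → Win (S ∪ ⁅ i ⁆)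

  Complete : Set
  Complete = (∀ i → AtLeast i i)
           × (∀ i j k → AtLeast i j → AtLeast j k → AtLeast i k)
           × (∀ i j → AtLeast i j ⊎ AtLeast j i)

  Dictator : Fin n → Set
  Dictator i = MinWin ⁅ i ⁆ × (∀ S → MinWin S → S ≡ ⁅ i ⁆)

  Veto : Fin n → Set
  Veto i = ∀ S → Win S → i ∈ S

  Passer : Fin n → Set
  Passer i = Win ⁅ i ⁆

  Null : Fin n → Set
  Null i = ∀ S → MinWin S → i ∉ S

  SemiVeto : Fin n → Set
  SemiVeto i = Win (∁ ⁅ i ⁆) × (∀ S → Win S → S ≢ ∁ ⁅ i ⁆ → i ∈ S)

  SemiPasser : Fin n → Set
  SemiPasser i = ¬ Win ⁅ i ⁆ × (∀ j → j ≢ i → Win (⁅ i ⁆ ∪ ⁅ j ⁆))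

  NumTypes : ℕ → Set
  NumTypes t = Σ (Fin t → Fin n) λ r →
                 (∀ a b → EqDes (r a) (r b) → a ≡ b) × (∀ i → ∃ λ a → EqDes i (r a))

data Label : Set where
  V P N SV SP : Label

HasRole : ∀ {n} → Game n → Label → Fin n → Set
HasRole W V  i = Veto W i
HasRole W P  i = Passer W i
HasRole W N  i = Null W i
HasRole W SV i = SemiVeto W i
HasRole W SP i = SemiPasser W i

image : ∀ {n} → Permutation′ n → Subset n → Subset n
image π S = tabulate λ j → lookup S (π ⟨$⟩ˡ j)

Iso : ∀ {n} → Game n → Game n → Set
Iso {n} W W′ = Σ (Permutation′ n) λ π → ∀ S → (Win W S → Win W′ (image π S)) × (Win W′ (image π S) → Win W S)

NumClasses : (A : Set) → (A → A → Set) → (A → Set) → ℕ → Set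
NumClasses A R Q k = Σ (Fin k → A) λ g →
    (∀ a → Q (g a)) × (∀ a b → R (g a) (g b) → a ≡ b) × (∀ x → Q x → ∃ λ a → R x (g a))

InCGD : ∀ {n} → List Label → Game n → Set
InCGD 𝒮 W = IsSimpleGame W × Complete W × (∃ λ i → Dictator W i)
          × (∀ l → l ∈ₗ 𝒮 → ∃ λ i → HasRole W l i)

CGD : List Label → (n : ℕ) → ℕ → Set
CGD 𝒮 n k = NumClasses (Game n) Iso (InCGD 𝒮) k

CGDt : List Label → (n t : ℕ) → ℕ → Set
CGDt 𝒮 n t k = NumClasses (Game n) Iso (λ W → InCGD 𝒮 W × NumTypes W t) k

-- A dictator d makes a coalition winning exactly when it contains d, so all
-- such games on n players are isomorphic to the dictatorship of one player.
-- A semi-veto player j ≠ d forces ⁅ d ⁆ = ∁ ⁅ j ⁆, and a semi-passer j ≠ d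
-- forces d into every pair ⁅ j ⁆ ∪ ⁅ k ⁆; either way d and j are the only
-- players, so n = 2. For n = 2 the dictatorship of player 0 has all five
-- roles, and its two players are not equally desirable, so it has 2 types.
module Submission where

open import Defs
open import Data.Nat using (ℕ; _≤_; _≡ᵇ_)
open import Data.Bool using (if_then_else_; _∧_)
open import Data.List using (List; []; _∷_; _++_)
open import Data.List.Relation.Unary.All using (All)
open import Data.List.Membership.Propositional using (_∈_)
open import Data.Product using (_×_)
open import Relation.Binary.PropositionalEquality using (_≢_)

open import Data.Nat using (zero; suc)
open import Data.Bool using (true; false)
open import Data.Bool.Properties using () renaming (_≟_ to _≟ᵇ_)
open import Data.Fin using (Fin; zero; suc; _≟_)
open import Data.Fin.Properties using (any?; cantor-schröder-bernstein)
open import Data.Fin.Subset using (_⊆_; _⊂_; ⁅_⁆; ∁; _∪_; ⊥; _-_) renaming (_∈_ to _∈ₛ_)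
open import Data.Fin.Subset.Properties
  using (_∈?_; ⊆-trans; ⊆-antisym; p─q⊆p; x∈p⇒p-x⊂p; x∈p∧x≢y⇒x∈p-y; ∈⊤; ∉⊥;
         x∈⁅x⁆; x∈⁅y⁆⇒x≡y; x∈∁p⇒x∉p; x∉p⇒x∈∁p; x∈p∪q⁺; x∈p∪q⁻)
open import Data.Fin.Subset.Induction using (Acc; acc; ⊂-wellFounded)
open import Data.Fin.Permutation using (transpose; _⟨$⟩ˡ_)
open import Data.Vec using ([]; _∷_; lookup; here; there)
open import Data.Vec.Properties using (lookup∘tabulate; []=⇒lookup; lookup⇒[]=)
open import Data.List.Relation.Unary.Any using () renaming (here to hereₗ; there to thereₗ)
open import Data.List.Relation.Unary.All using (_∷_)
open import Data.List.Membership.Propositional.Properties using (∈-++⁺ʳ)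
open import Data.Product using (∃; _,_; proj₁; proj₂)
open import Data.Sum using (_⊎_; inj₁; inj₂; [_,_]′)
open import Data.Empty using (⊥-elim)
open import Function using (id; _∘_)
open import Relation.Nullary using (¬_; yes; no)
open import Relation.Nullary.Decidable using (_×-dec_; decidable-stable; dec-true)
open import Relation.Binary.PropositionalEquality using (_≡_; refl; sym; trans; cong; subst)

private
  variable
    n : ℕ

injective∧surjective⇒≡ : ∀ {m} (r : Fin m → Fin n) → (∀ {a b} → r a ≡ r b → a ≡ b)
  → (∀ k → ∃ λ a → k ≡ r a) → m ≡ n
injective∧surjective⇒≡ r r-injective r-onto = cantor-schröder-bernstein r-injective section-injective
  where
  section-injective : ∀ {k l} → proj₁ (r-onto k) ≡ proj₁ (r-onto l) → k ≡ l
  section-injective {k} {l} eq =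
    trans (proj₂ (r-onto k)) (trans (cong r eq) (sym (proj₂ (r-onto l))))

covered-by-two⇒≡2 : (i j : Fin n) → i ≢ j → (∀ k → k ≡ i ⊎ k ≡ j) → n ≡ 2
covered-by-two⇒≡2 i j i≢j cover = sym (injective∧surjective⇒≡ pair pair-injective pair-onto)
  where
  pair : Fin 2 → Fin _
  pair zero       = i
  pair (suc zero) = j

  pair-injective : ∀ {a b} → pair a ≡ pair b → a ≡ b
  pair-injective {zero}     {zero}     _  = refl
  pair-injective {zero}     {suc zero} eq = ⊥-elim (i≢j eq)
  pair-injective {suc zero} {zero}     eq = ⊥-elim (i≢j (sym eq))
  pair-injective {suc zero} {suc zero} _  = refl

  pair-onto : ∀ k → ∃ λ a → k ≡ pair a
  pair-onto k = [ (λ k≡i → zero , k≡i) , (λ k≡j → suc zero , k≡j) ]′ (cover k)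

noClasses : ∀ {A : Set} {R : A → A → Set} {Q : A → Set} → (∀ x → ¬ Q x) → NumClasses A R Q 0
noClasses ¬Q = (λ ()) , (λ ()) , (λ ()) , λ x q → ⊥-elim (¬Q x q)

oneClass : ∀ {A : Set} {R : A → A → Set} {Q : A → Set} {x} → Q x → (∀ y → Q y → R y x)
  → NumClasses A R Q 1
oneClass {x = x} qx toX = (λ _ → x) , (λ _ → qx) , (λ { zero zero _ → refl }) , λ y qy → zero , toX y qy

⁅x⁆⊆p : ∀ {x : Fin n} {p} → x ∈ₛ p → ⁅ x ⁆ ⊆ p
⁅x⁆⊆p {x = x} x∈p y∈⁅x⁆ = subst (_∈ₛ _) (sym (x∈⁅y⁆⇒x≡y x y∈⁅x⁆)) x∈p

x∈⊥∪⁅x⁆ : (x : Fin n) → x ∈ₛ ⊥ ∪ ⁅ x ⁆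
x∈⊥∪⁅x⁆ x = x∈p∪q⁺ (inj₂ (x∈⁅x⁆ x))

x∈⊥∪⁅y⁆⇒x≡y : ∀ {x} (y : Fin n) → x ∈ₛ ⊥ ∪ ⁅ y ⁆ → x ≡ y
x∈⊥∪⁅y⁆⇒x≡y y = [ ⊥-elim ∘ ∉⊥ , x∈⁅y⁆⇒x≡y y ]′ ∘ x∈p∪q⁻ ⊥ ⁅ y ⁆

win⇒minWin⊆ : (W : Game n) → (∀ S T → S ⊆ T → Win W S → Win W T)
  → ∀ S → Win W S → ∃ λ T → T ⊆ S × MinWin W T
win⇒minWin⊆ W mono S = go S (⊂-wellFounded S)
  where
  go : ∀ S → Acc _⊂_ S → Win W S → ∃ λ T → T ⊆ S × MinWin W T
  go S (acc rec) wS with any? (λ x → x ∈? S ×-dec (W (S - x) ≟ᵇ true))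
  ... | yes (x , x∈S , wS-x) =
    let T , T⊆S-x , minT = go (S - x) (rec (x∈p⇒p-x⊂p x∈S)) wS-x
    in T , ⊆-trans T⊆S-x (p─q⊆p S ⁅ x ⁆) , minT
  ... | no irremovable = S , id , wS , minimal
    where
    -- an element y of S missing from a winning T ⊆ S would be removable from S
    minimal : ∀ T → T ⊆ S → Win W T → T ≡ S
    minimal T T⊆S wT = ⊆-antisym T⊆S λ {y} y∈S → decidable-stable (y ∈? T) λ y∉T →
      irremovable (y , y∈S , mono T (S - y)
        (λ z∈T → x∈p∧x≢y⇒x∈p-y (T⊆S z∈T) λ { refl → y∉T z∈T }) wT)

module Dictatorial {W : Game n} (simple : IsSimpleGame W) {d : Fin n} (dictator : Dictator W d) where

  private
    mono = proj₂ (proj₂ simple)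
    win⁅d⁆ = proj₁ (proj₁ dictator)

  win⇒dictator∈ : ∀ {S} → Win W S → d ∈ₛ S
  win⇒dictator∈ {S} wS with win⇒minWin⊆ W mono S wS
  ... | T , T⊆S , minT = T⊆S (subst (d ∈ₛ_) (sym (proj₂ dictator T minT)) (x∈⁅x⁆ d))

  dictator∈⇒win : ∀ {S} → d ∈ₛ S → Win W S
  dictator∈⇒win d∈S = mono _ _ (⁅x⁆⊆p d∈S) win⁅d⁆

  dictator-veto : Veto W d
  dictator-veto _ = win⇒dictator∈

  dictator-passer : Passer W d
  dictator-passer = win⁅d⁆

  nondictator-null : ∀ {j} → j ≢ d → Null W j
  nondictator-null j≢d S minS j∈S =
    j≢d (x∈⁅y⁆⇒x≡y d (subst (_ ∈ₛ_) (proj₂ dictator S minS) j∈S))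

  dictator-≈⇒≡ : ∀ {j} → EqDes W d j → d ≡ j
  dictator-≈⇒≡ {j} d≈j =
    x∈⊥∪⁅y⁆⇒x≡y j (win⇒dictator∈ (proj₁ (d≈j ⊥ ∉⊥ ∉⊥) (dictator∈⇒win (x∈⊥∪⁅x⁆ d))))

  semiVeto⇒≡2 : ∀ {j} → SemiVeto W j → n ≡ 2
  semiVeto⇒≡2 {j} (win∁⁅j⁆ , semiVeto) = covered-by-two⇒≡2 d j d≢j cover
    where
    d≢j : d ≢ j
    d≢j refl = x∈∁p⇒x∉p (win⇒dictator∈ win∁⁅j⁆) (x∈⁅x⁆ d)

    -- a third player k would witness ⁅ d ⁆ ≢ ∁ ⁅ j ⁆, so j ∈ ⁅ d ⁆
    cover : ∀ k → k ≡ d ⊎ k ≡ j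
    cover k with k ≟ d | k ≟ j
    ... | yes k≡d | _       = inj₁ k≡d
    ... | no _    | yes k≡j = inj₂ k≡j
    ... | no k≢d  | no k≢j  = ⊥-elim (d≢j (sym (x∈⁅y⁆⇒x≡y d (semiVeto ⁅ d ⁆ win⁅d⁆ ⁅d⁆≢∁⁅j⁆))))
      where
      ⁅d⁆≢∁⁅j⁆ : ⁅ d ⁆ ≢ ∁ ⁅ j ⁆
      ⁅d⁆≢∁⁅j⁆ eq = k≢d (x∈⁅y⁆⇒x≡y d (subst (k ∈ₛ_) (sym eq)
        (x∉p⇒x∈∁p (k≢j ∘ x∈⁅y⁆⇒x≡y j))))

  semiPasser⇒≡2 : ∀ {j} → SemiPasser W j → n ≡ 2
  semiPasser⇒≡2 {j} (¬win⁅j⁆ , semiPasser) = covered-by-two⇒≡2 d j d≢j cover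
    where
    d≢j : d ≢ j
    d≢j refl = ¬win⁅j⁆ win⁅d⁆

    cover : ∀ k → k ≡ d ⊎ k ≡ j
    cover k with k ≟ j
    ... | yes k≡j = inj₂ k≡j
    ... | no k≢j with x∈p∪q⁻ ⁅ j ⁆ ⁅ k ⁆ (win⇒dictator∈ (semiPasser k k≢j))
    ...   | inj₁ d∈⁅j⁆ = ⊥-elim (d≢j (x∈⁅y⁆⇒x≡y j d∈⁅j⁆))
    ...   | inj₂ d∈⁅k⁆ = inj₁ (sym (x∈⁅y⁆⇒x≡y k d∈⁅k⁆))

open Dictatorial public

dictatorship : Fin n → Game n
dictatorship d S = lookup S d

module _ {d : Fin n} where

  private
    ∈⇒win : ∀ {S} → d ∈ₛ S → Win (dictatorship d) S
    ∈⇒win = []=⇒lookup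

    win⇒∈ : ∀ {S} → Win (dictatorship d) S → d ∈ₛ S
    win⇒∈ = lookup⇒[]= d _

  dictatorship-simple : IsSimpleGame (dictatorship d)
  dictatorship-simple = ∈⇒win ∈⊤ , ∉⊥ ∘ win⇒∈ , λ _ _ S⊆T → ∈⇒win ∘ S⊆T ∘ win⇒∈

  dictatorship-dictator : Dictator (dictatorship d) d
  dictatorship-dictator = (win⁅d⁆ , minimal) , λ S (wS , minS) →
    sym (minS ⁅ d ⁆ (⁅x⁆⊆p (win⇒∈ wS)) win⁅d⁆)
    where
    win⁅d⁆ = ∈⇒win (x∈⁅x⁆ d)
    minimal : ∀ T → T ⊆ ⁅ d ⁆ → Win (dictatorship d) T → T ≡ ⁅ d ⁆
    minimal T T⊆⁅d⁆ wT = ⊆-antisym T⊆⁅d⁆ (⁅x⁆⊆p (win⇒∈ wT))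

  atLeast-dictatorship : ∀ {i j} → i ≡ d ⊎ j ≢ d → AtLeast (dictatorship d) i j
  atLeast-dictatorship (inj₁ refl) S _ _ _ = ∈⇒win {S ∪ ⁅ d ⁆} (x∈p∪q⁺ (inj₂ (x∈⁅x⁆ d)))
  atLeast-dictatorship {j = j} (inj₂ j≢d) S _ _ w with x∈p∪q⁻ S ⁅ j ⁆ (win⇒∈ w)
  ... | inj₁ d∈S   = ∈⇒win {S ∪ _} (x∈p∪q⁺ (inj₁ d∈S))
  ... | inj₂ d∈⁅j⁆ = ⊥-elim (j≢d (sym (x∈⁅y⁆⇒x≡y j d∈⁅j⁆)))

  atLeast-dictatorship⁻ : ∀ {i j} → AtLeast (dictatorship d) i j → i ≡ d ⊎ j ≢ d
  atLeast-dictatorship⁻ {i} i≿j with i ≟ d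
  ... | yes i≡d = inj₁ i≡d
  ... | no i≢d  = inj₂ λ { refl →
    i≢d (sym (x∈⊥∪⁅y⁆⇒x≡y i (win⇒∈ (i≿j ⊥ ∉⊥ ∉⊥ (∈⇒win {⊥ ∪ ⁅ d ⁆} (x∈⊥∪⁅x⁆ d)))))) }

  dictatorship-complete : Complete (dictatorship d)
  dictatorship-complete = (λ _ _ _ _ → id) , transitive , total
    where
    transitive : ∀ i j k → AtLeast (dictatorship d) i j → AtLeast (dictatorship d) j k
      → AtLeast (dictatorship d) i k
    transitive i j k i≿j j≿k with atLeast-dictatorship⁻ i≿j | atLeast-dictatorship⁻ j≿k
    ... | inj₁ i≡d | _        = atLeast-dictatorship (inj₁ i≡d)
    ... | inj₂ j≢d | inj₁ j≡d = ⊥-elim (j≢d j≡d)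
    ... | inj₂ _   | inj₂ k≢d = atLeast-dictatorship (inj₂ k≢d)

    total : ∀ i j → AtLeast (dictatorship d) i j ⊎ AtLeast (dictatorship d) j i
    total i j with i ≟ d
    ... | yes i≡d = inj₁ (atLeast-dictatorship (inj₁ i≡d))
    ... | no i≢d  = inj₂ (atLeast-dictatorship (inj₂ i≢d))

transpose-sendsˡ : (d e : Fin n) → transpose d e ⟨$⟩ˡ e ≡ d
transpose-sendsˡ d e rewrite dec-true (e ≟ e) refl = refl

dictatorial-≅-dictatorship : {W : Game n} → IsSimpleGame W → ∀ {d} → Dictator W d
  → ∀ e → Iso W (dictatorship e)
dictatorial-≅-dictatorship simple {d} dictator e = transpose d e , λ S →
    (λ wS → trans (lookup-image S) ([]=⇒lookup (win⇒dictator∈ simple dictator wS)))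
  , (λ w → dictator∈⇒win simple dictator (lookup⇒[]= d S (trans (sym (lookup-image S)) w)))
  where
  lookup-image : ∀ S → lookup (image (transpose d e) S) e ≡ lookup S d
  lookup-image S = trans (lookup∘tabulate _ e) (cong (lookup S) (transpose-sendsˡ d e))

≈-refl : ∀ (W : Game n) {i} → EqDes W i i
≈-refl _ _ _ _ = id , id

≈-sym : ∀ (W : Game n) {i j} → EqDes W i j → EqDes W j i
≈-sym _ i≈j S j∉S i∉S = proj₂ (i≈j S i∉S j∉S) , proj₁ (i≈j S i∉S j∉S)

module _ (W : Game n) (discrete : ∀ {i j} → EqDes W i j → i ≡ j) where

  numTypes-self : NumTypes W n
  numTypes-self = id , (λ _ _ → discrete) , λ i → i , ≈-refl W

  numTypes⇒≡ : ∀ {t} → NumTypes W t → t ≡ n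
  numTypes⇒≡ (r , r-injective , r-onto) = injective∧surjective⇒≡ r
    (λ {a} eq → r-injective a _ (subst (EqDes W (r a)) eq (≈-refl W)))
    (λ i → proj₁ (r-onto i) , discrete (proj₂ (r-onto i)))

-- of two distinct players, one is the dictator
dictatorial₂-discrete : {W : Game 2} → IsSimpleGame W → ∀ {d} → Dictator W d
  → ∀ {i j} → EqDes W i j → i ≡ j
dictatorial₂-discrete _ _ {zero}     {zero}     _ = refl
dictatorial₂-discrete _ _ {suc zero} {suc zero} _ = refl
dictatorial₂-discrete simple {zero} dictator {zero} {suc zero} i≈j =
  dictator-≈⇒≡ simple dictator i≈j
dictatorial₂-discrete {W} simple {zero} dictator {suc zero} {zero} i≈j =
  sym (dictator-≈⇒≡ simple dictator (≈-sym W i≈j))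
dictatorial₂-discrete {W} simple {suc zero} dictator {zero} {suc zero} i≈j =
  sym (dictator-≈⇒≡ simple dictator (≈-sym W i≈j))
dictatorial₂-discrete simple {suc zero} dictator {suc zero} {zero} i≈j =
  dictator-≈⇒≡ simple dictator i≈j

dictatorship₂ : Game 2
dictatorship₂ = dictatorship zero

module Dictatorship₂ = Dictatorial {W = dictatorship₂} dictatorship-simple {zero} dictatorship-dictator

dictatorship₂-discrete : ∀ {i j} → EqDes dictatorship₂ i j → i ≡ j
dictatorship₂-discrete = dictatorial₂-discrete dictatorship-simple {zero} dictatorship-dictator

dictatorship₂-roles : ∀ l → ∃ λ i → HasRole dictatorship₂ l i
dictatorship₂-roles V  = zero , Dictatorship₂.dictator-veto
dictatorship₂-roles P  = zero , Dictatorship₂.dictator-passer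
dictatorship₂-roles N  = suc zero , Dictatorship₂.nondictator-null {suc zero} λ ()
dictatorship₂-roles SV = suc zero , refl , semiVeto
  where
  semiVeto : ∀ S → Win dictatorship₂ S → S ≢ ∁ ⁅ suc zero ⁆ → suc zero ∈ₛ S
  semiVeto (true ∷ true ∷ [])  _ _      = there here
  semiVeto (true ∷ false ∷ []) _ S≢∁⁅1⁆ = ⊥-elim (S≢∁⁅1⁆ refl)
  semiVeto (false ∷ _ ∷ [])    () _
dictatorship₂-roles SP = suc zero , (λ ()) , semiPasser
  where
  semiPasser : ∀ j → j ≢ suc zero → Win dictatorship₂ (⁅ suc zero ⁆ ∪ ⁅ j ⁆)
  semiPasser zero       _   = refl
  semiPasser (suc zero) j≢1 = ⊥-elim (j≢1 refl)

dictatorship₂-inCGD : ∀ 𝒮 → InCGD 𝒮 dictatorship₂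
dictatorship₂-inCGD _ = dictatorship-simple , dictatorship-complete , (zero , dictatorship-dictator)
  , λ l _ → dictatorship₂-roles l

inCGD-≅-dictatorship₂ : ∀ {𝒮} W → InCGD 𝒮 W → Iso W dictatorship₂
inCGD-≅-dictatorship₂ W (simple , _ , (_ , dictator) , _) = dictatorial-≅-dictatorship simple dictator zero

inCGD-numTypes₂⇒≡2 : ∀ {𝒮 t} W → InCGD 𝒮 W → NumTypes W t → t ≡ 2
inCGD-numTypes₂⇒≡2 W (simple , _ , (_ , dictator) , _) = numTypes⇒≡ W (dictatorial₂-discrete simple dictator)

cgdt₂-absent : ∀ {𝒮 t} → t ≢ 2 → CGDt 𝒮 2 t 0
cgdt₂-absent t≢2 = noClasses {R = Iso} λ W (inW , types) → t≢2 (inCGD-numTypes₂⇒≡2 W inW types)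

cgd₂ : ∀ 𝒮 → CGD 𝒮 2 1
cgd₂ 𝒮 = oneClass {R = Iso} (dictatorship₂-inCGD 𝒮) inCGD-≅-dictatorship₂

cgdt₂ : ∀ 𝒮 t → CGDt 𝒮 2 t (if t ≡ᵇ 2 then 1 else 0)
cgdt₂ 𝒮 0                   = cgdt₂-absent λ ()
cgdt₂ 𝒮 1                   = cgdt₂-absent λ ()
cgdt₂ 𝒮 2                   = oneClass {R = Iso}
  (dictatorship₂-inCGD 𝒮 , numTypes-self dictatorship₂ dictatorship₂-discrete)
  λ W (inW , _) → inCGD-≅-dictatorship₂ W inW
cgdt₂ 𝒮 (suc (suc (suc _))) = cgdt₂-absent λ ()

inCGD-semi⇒≡2 : ∀ 𝒮₁ 𝒮₂ → All (_∈ SV ∷ SP ∷ []) 𝒮₂ → 𝒮₂ ≢ []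
  → (W : Game n) → InCGD (𝒮₁ ++ 𝒮₂) W → n ≡ 2
inCGD-semi⇒≡2 𝒮₁ [] _ 𝒮₂≢[] _ _ = ⊥-elim (𝒮₂≢[] refl)
inCGD-semi⇒≡2 𝒮₁ (l ∷ _) (l∈semi ∷ _) _ W (simple , _ , (_ , dictator) , roles) =
  semi l∈semi (roles l (∈-++⁺ʳ 𝒮₁ (hereₗ refl)))
  where
  semi : ∀ {l} → l ∈ SV ∷ SP ∷ [] → ∃ (HasRole W l) → _ ≡ 2
  semi (hereₗ refl)          (_ , semiVeto)   = semiVeto⇒≡2 simple dictator semiVeto
  semi (thereₗ (hereₗ refl)) (_ , semiPasser) = semiPasser⇒≡2 simple dictator semiPasser

mainTheorem6 : (𝒮₁ 𝒮₂ : List Label)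
    → All (_∈ V ∷ P ∷ N ∷ []) 𝒮₁
    → All (_∈ SV ∷ SP ∷ []) 𝒮₂
    → 𝒮₂ ≢ []
    → (n : ℕ) → 1 ≤ n
    → CGD (𝒮₁ ++ 𝒮₂) n (if n ≡ᵇ 2 then 1 else 0)
      × ((t : ℕ) → CGDt (𝒮₁ ++ 𝒮₂) n t (if (n ≡ᵇ 2) ∧ (t ≡ᵇ 2) then 1 else 0))
mainTheorem6 𝒮₁ 𝒮₂ _ 𝒮₂-semi 𝒮₂≢[] = λ
  { 2 _ → cgd₂ _ , cgdt₂ _
  ; 0 _ → absent λ ()
  ; 1 _ → absent λ ()
  ; (suc (suc (suc _))) _ → absent λ () }
  where
  absent : ∀ {n} → n ≢ 2 → CGD (𝒮₁ ++ 𝒮₂) n 0 × (∀ t → CGDt (𝒮₁ ++ 𝒮₂) n t 0)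
  absent n≢2 = noClasses {R = Iso} (λ W → n≢2 ∘ inCGD-semi⇒≡2 𝒮₁ 𝒮₂ 𝒮₂-semi 𝒮₂≢[] W)
    , λ _ → noClasses {R = Iso} λ W → n≢2 ∘ inCGD-semi⇒≡2 𝒮₁ 𝒮₂ 𝒮₂-semi 𝒮₂≢[] W ∘ proj₁
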